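{- Let $(G,\sigma)$ be a qBMG with vertex set $L$, and let $T$ be the tree produced by the algorithm MTT with input $(\mathscr{R}(G,\sigma),\mathscr{F}(G,\sigma))$ and $L$. Then there is a truncation map $u$ such that $(T,\sigma,u)$ explains $(G,\sigma)$ and $(T,\sigma,u)$ is least resolved.
   Context: Digraphs are finite and simple, colorings proper. All rooted trees are phylogenetic; $v\preceq_T u$ means $u$ is on the path from root $\rho_T$ to $v$; $\mathrm{lca}_T$ is the least common ancestor. Best match: in leaf-colored $(T,\sigma)$, $y$ is a best match of $x$ if $\sigma(x)\ne\sigma(y)$ and $\mathrm{lca}_T(x,y)\preceq_T\mathrm{lca}_T(x,y')$ for all leaves $y'$ with $\sigma(y')=\sigma(y)$. A truncation map $u\colon L(T)\times S\to V(T)$ (with $\sigma(L(T))\subseteq S$) sends $(x,s)$ to a vertex on the path from $\rho_T$ to $x$, with $u(x,\sigma(x))=x$; $y$ is a quasi-best match of $x$ if it is a best match and $\mathrm{lca}_T(x,y)\preceq_T u(x,\sigma(y))$; $(T,\sigma,u)$ explains the vertex-colored digraph on $L(T)$ with arcs $xy$ for quasi-best matches $y$ of $x$; qBMGs are the digraphs so explained. $(T,\sigma,u)$ is least resolved if there is no tree $T'$ obtained from $T$ by a non-empty sequence of inner-edge contractions and truncation map $u'$ such that $(T',\sigma,u')$ explains the same digraph. A tree displays triple $ab|c$ if $a,b,c$ are distinct leaves with $\mathrm{lca}_T(a,b)\prec_T\mathrm{lca}_T(a,c)$. $\mathscr{R}(G,\sigma)=\{ab|b' : \sigma(a)\ne\sigma(b)=\sigma(b'),\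 ab\in E(G),\ ab'\notin E(G)\}$, $\mathscr{F}(G,\sigma)=\{ab|b' : \sigma(a)\ne\sigma(b)=\sigma(b'),\ b\ne b',\ ab,ab'\in E(G)\}$. For a triple set $\mathscr{X}$ and $L'\subseteq L$, $\mathscr{X}_{L'}$ consists of the triples with all leaves in $L'$; the Aho graph $[\mathscr{R}_{L'},L']$ has vertex set $L'$ and edges $xy$ whenever $xy|z\in\mathscr{R}_{L'}$ for some $z$. Algorithm MTT (He et al.) on $(\mathscr{R},\mathscr{F})$ and $L'$: if $|L'|=1$ return the single vertex; otherwise start from the partition of $L'$ into connected components of $[\mathscr{R}_{L'},L']$ and repeatedly merge two parts $C,C'$ whenever some $ab|c\in\mathscr{F}_{L'}$ has $a,b\in C$, $c\in C'$; if finally only one part remains it reports inconsistency, otherwise it recurses on each part $D$ with $(\mathscr{R}_D,\mathscr{F}_D)$ and returns the tree with a new root whose children are the roots of the recursively obtained trees. -}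

module Defs where

open import Level using (Level)
open import Data.Nat using (ℕ)
open import Data.Bool using (Bool; true; false)
open import Data.Fin using (Fin)
open import Data.Fin.Subset using (Subset; _∈_; _∉_; _⊆_; ⊤; ⁅_⁆; _∩_; Nonempty; Empty)
open import Data.Product using (Σ; ∃; _×_; _,_)
open import Data.Sum using (_⊎_)
open import Relation.Nullary using (¬_)
open import Relation.Binary.PropositionalEquality using (_≡_; _≢_)
open import Relation.Binary.Construct.Closure.ReflexiveTransitive using (Star)
open import Relation.Binary.Construct.Closure.Transitive using (TransClosure)
open import Function.Bundles using (_⇔_)

-- Rooted phylogenetic trees on leaf set L = Fin n, represented by their
-- hierarchy of clusters: each vertex v is identified with its cluster
-- C(v) = set of leaves below v.  isCl C ≡ true iff C is the cluster of a
-- vertex.  The root has cluster ⊤ (= L), leaf x has cluster ⁅ x ⁆, and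
-- v ⪯ w iff C(v) ⊆ C(w).

record Tree (n : ℕ) : Set where
  field
    isCl     : Subset n → Bool
    root     : isCl ⊤ ≡ true
    leaves   : ∀ x → isCl ⁅ x ⁆ ≡ true
    nonempty : ∀ C → isCl C ≡ true → Nonempty C
    compat   : ∀ C D → isCl C ≡ true → isCl D ≡ true →
               C ⊆ D ⊎ D ⊆ C ⊎ Empty (C ∩ D)
open Tree public

module _ {n : ℕ} where

  Digraph : Set
  Digraph = Fin n → Fin n → Bool

  -- triple sets: (a , b , c) ∈ X represents ab|c
  Triples : Set₁
  Triples = Fin n → Fin n → Fin n → Set

  Vertex : Tree n → Subset n → Set
  Vertex T C = isCl T C ≡ true

  IsLca : Tree n → Fin n → Fin n → Subset n → Set
  IsLca T x y C = Vertex T C × x ∈ C × y ∈ C ×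
                  (∀ D → Vertex T D → x ∈ D → y ∈ D → C ⊆ D)

  module _ {k : ℕ} where

    BestMatch : Tree n → (Fin n → Fin k) → Fin n → Fin n → Set
    BestMatch T σ x y =
      σ x ≢ σ y ×
      (∀ y' → σ y' ≡ σ y → ∀ C C' → IsLca T x y C → IsLca T x y' C' → C ⊆ C')

    record Truncation (T : Tree n) (σ : Fin n → Fin k) : Set where
      field
        map    : Fin n → Fin k → Subset n
        vertex : ∀ x s → Vertex T (map x s)
        onPath : ∀ x s → x ∈ map x s          -- map x s lies on the path ρ_T → x
        self   : ∀ x → map x (σ x) ≡ ⁅ x ⁆
    open Truncation public

    QuasiBestMatch : (T : Tree n) (σ : Fin n → Fin k) → Truncation T σ →
                     Fin n → Fin n → Set
    QuasiBestMatch T σ u x y =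
      BestMatch T σ x y × (∀ C → IsLca T x y C → C ⊆ map u x (σ y))

    Explains : (T : Tree n) (σ : Fin n → Fin k) → Truncation T σ → Digraph → Set
    Explains T σ u G = ∀ x y → (G x y ≡ true) ⇔ QuasiBestMatch T σ u x y

    IsQBMG : Digraph → (Fin n → Fin k) → Set
    IsQBMG G σ = Σ (Tree n) λ T → Σ (Truncation T σ) λ u → Explains T σ u G

  -- contraction of one inner edge (parent(C), C): C is neither the root
  -- nor a leaf, and the vertex C is removed.
  Contract : Tree n → Tree n → Set
  Contract T T' = Σ (Subset n) λ C → Vertex T C × C ≢ ⊤ × (∀ x → C ≢ ⁅ x ⁆) ×
                  (∀ D → Vertex T' D ⇔ (Vertex T D × D ≢ C))

  module _ {k : ℕ} where

    LeastResolved : (T : Tree n) (σ : Fin n → Fin k) → Truncation T σ → Digraph → Set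
    LeastResolved T σ u G =
      ¬ (Σ (Tree n) λ T' → TransClosure Contract T T' ×
           Σ (Truncation T' σ) λ u' → Explains T' σ u' G)

    ℛ : Digraph → (Fin n → Fin k) → Triples
    ℛ G σ a b c = σ a ≢ σ b × σ b ≡ σ c × G a b ≡ true × G a c ≡ false

    ℱ : Digraph → (Fin n → Fin k) → Triples
    ℱ G σ a b c = σ a ≢ σ b × σ b ≡ σ c × b ≢ c × G a b ≡ true × G a c ≡ true

  -- Algorithm MTT.  Triples are always restricted to the current leaf set
  -- L', so passing (ℛ , ℱ) unchanged equals passing (ℛ_D , ℱ_D).

  Triple∈ : Subset n → Fin n → Fin n → Fin n → Set
  Triple∈ L' a b c = a ∈ L' × b ∈ L' × c ∈ L'

  AhoEdge : Triples → Subset n → Fin n → Fin n → Set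
  AhoEdge R L' x y = ∃ λ z → Triple∈ L' x y z × (R x y z ⊎ R y x z)

  -- partitions of L' given by their "same part" relation
  -- initial partition: connected components of the Aho graph
  Components : Triples → Subset n → Fin n → Fin n → Set
  Components R L' x y = x ∈ L' × y ∈ L' × Star (AhoEdge R L') x y

  merged : (Fin n → Fin n → Set) → Fin n → Fin n → (Fin n → Fin n → Set)
  merged P a c x y = P x y ⊎ (P x a × P c y) ⊎ (P x c × P a y)

  data MergeStep (F : Triples) (L' : Subset n) (P : Fin n → Fin n → Set) :
       (Fin n → Fin n → Set) → Set₁ where
    merge : ∀ a b c → F a b c → Triple∈ L' a b c → P a b → ¬ P a c →
            MergeStep F L' P (merged P a c)

  Stable : Triples → Subset n → (Fin n → Fin n → Set) → Set
  Stable F L' P = ∀ a b c → F a b c → Triple∈ L' a b c → P a b → P a c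

  IsPart : Subset n → (Fin n → Fin n → Set) → Subset n → Set
  IsPart L' P D = ∃ λ x → x ∈ L' × (∀ y → y ∈ D ⇔ (y ∈ L' × P x y))

  -- MTT R F L' H : running MTT on (R , F) and L' returns the tree whose
  -- set of clusters is H (a tree on L' given by its hierarchy).
  data MTT (R F : Triples) : Subset n → (Subset n → Set) → Set₁ where
    single : ∀ {L' H} x → (∀ y → y ∈ L' ⇔ y ≡ x) → (∀ C → H C ⇔ C ≡ L') →
             MTT R F L' H
    split  : ∀ {L' H} →
             (∃ λ x → ∃ λ y → x ∈ L' × y ∈ L' × x ≢ y) →
             (P : Fin n → Fin n → Set) →
             Star (MergeStep F L') (Components R L') P →
             Stable F L' P →
             ¬ (∀ x y → x ∈ L' → y ∈ L' → P x y) →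
             (Hs : Subset n → Subset n → Set) →
             (∀ D → IsPart L' P D → MTT R F D (Hs D)) →
             (∀ C → H C ⇔ (C ≡ L' ⊎ Σ (Subset n) λ D → IsPart L' P D × Hs D C)) →
             MTT R F L' H

-- The clusters of the MTT tree T display every triple of ℛ(G, σ) and no triple of ℱ(G, σ).
-- With u(x, s) the root when x has an out-arc of colour s and the leaf x otherwise, this makes the
-- quasi-best matches of (T, σ, u) exactly the arcs of G. Any tree explaining G displays ℛ, so a
-- tree obtained by contractions would display ℛ without some inner cluster D of T. But the MTT
-- partition of a leaf set is the finest ℱ-stable partition coarser than the Aho components, and
-- refining it by splitting D into the parts MTT chose inside D keeps every Aho edge and stays
-- ℱ-stable; hence MTT could not have split D.

module Submission where

open import Defs
open import Level using (0ℓ)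
open import Data.Nat using (ℕ; zero; suc)
open import Data.Bool using (true; false)
import Data.Bool.Properties as Bool
open import Data.Fin using (Fin; zero; suc) renaming (_≟_ to _≟ᶠ_)
open import Data.Fin.Properties using (any?)
open import Data.Fin.Subset using (Subset; _∈_; _∉_; _⊆_; _⊂_; ⊤; ⁅_⁆)
open import Data.Fin.Subset.Properties
  using (_∈?_; _⊂?_; anySubset?; ⊆-antisym; drop-there; ∈⊤; ⊆⊤; x∈⁅x⁆; x∈⁅y⁆⇒x≡y; x∈p∩q⁺)
open import Data.Fin.Subset.Induction using (⊂-wellFounded)
open import Data.Vec using ([]; _∷_; here; there)
open import Data.Vec.Properties using (≡-dec)
open import Data.Product using (Σ; ∃; _×_; _,_; proj₁; proj₂)
open import Data.Sum as Sum using (_⊎_; inj₁; inj₂)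
open import Data.Empty using (⊥; ⊥-elim)
open import Function using (_∘_; const)
open import Function.Bundles using (_⇔_; mk⇔; Equivalence)
open import Induction.WellFounded using (Acc; acc)
open import Relation.Nullary using (¬_; Dec; yes; no; does)
open import Relation.Nullary.Decidable using (_×-dec_; ¬¬-excluded-middle; decidable-stable)
open import Relation.Binary.Core using (Rel; _⇒_)
open import Relation.Binary.Definitions using (Symmetric; Transitive)
open import Relation.Binary.PropositionalEquality as ≡ using (_≡_; _≢_; refl)
open import Relation.Binary.Construct.Closure.ReflexiveTransitive as Star
  using (Star; ε; _◅_; return)
open import Relation.Binary.Construct.Closure.Transitive using (TransClosure; [_]; _∷_)

open Equivalence using (to; from)

private
  variable
    n k : ℕ
    L' C D : Subset n
    P : Rel (Fin n) 0ℓ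
    H H' : Subset n → Set
    a b c x y : Fin n
    T T' : Tree n

-- Relations built by MTT need not be decidable, so their parts exist as subsets only up to
-- double negation; this suffices because everything derived from the parts below is negative.
¬¬-comprehension : (Q : Fin n → Set) → ¬ ¬ (∃ λ D → ∀ i → i ∈ D ⇔ Q i)
¬¬-comprehension {zero}  Q refute = refute ([] , λ ())
¬¬-comprehension {suc n} Q refute =
  ¬¬-excluded-middle λ Q₀? → ¬¬-comprehension (Q ∘ suc) λ (D , D⇔) →
    refute (does Q₀? ∷ D , λ { zero → zero⇔ Q₀?
                             ; (suc i) → mk⇔ (to (D⇔ i) ∘ drop-there) (there ∘ from (D⇔ i)) })
  where
  zero⇔ : ∀ {D} (Q₀? : Dec (Q zero)) → zero ∈ does Q₀? ∷ D ⇔ Q zero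
  zero⇔ (yes q) = mk⇔ (const q) (const here)
  zero⇔ (no ¬q) = mk⇔ (λ ()) (⊥-elim ∘ ¬q)

record IsEquivalenceOn (L' : Subset n) (P : Rel (Fin n) 0ℓ) : Set where
  field
    domain : ∀ {x y} → P x y → x ∈ L' × y ∈ L'
    reflOn : ∀ {x} → x ∈ L' → P x x
    sym    : Symmetric P
    trans  : Transitive P
open IsEquivalenceOn

module _ (R : Triples {n}) (L' : Subset n) where

  AhoEdge-sym : Symmetric (AhoEdge R L')
  AhoEdge-sym (z , (x∈ , y∈ , z∈) , r) = z , (y∈ , x∈ , z∈) , Sum.swap r

  Components-isEquivalenceOn : IsEquivalenceOn L' (Components R L')
  Components-isEquivalenceOn = record
    { domain = λ (x∈ , y∈ , _) → x∈ , y∈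
    ; reflOn = λ x∈ → x∈ , x∈ , ε
    ; sym    = λ (x∈ , y∈ , path) → y∈ , x∈ , Star.reverse AhoEdge-sym path
    ; trans  = λ (x∈ , _ , path) (_ , z∈ , path') → x∈ , z∈ , path Star.◅◅ path'
    }

merged-isEquivalenceOn : ∀ a c → IsEquivalenceOn L' P → IsEquivalenceOn L' (merged P a c)
merged-isEquivalenceOn {L' = L'} {P = P} a c E = record
  { domain = domain′ ; reflOn = inj₁ ∘ reflOn E ; sym = sym′ ; trans = trans′ }
  where
  domain′ : merged P a c x y → x ∈ L' × y ∈ L'
  domain′ (inj₁ p)             = domain E p
  domain′ (inj₂ (inj₁ (p , q))) = proj₁ (domain E p) , proj₂ (domain E q)
  domain′ (inj₂ (inj₂ (p , q))) = proj₁ (domain E p) , proj₂ (domain E q)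

  sym′ : Symmetric (merged P a c)
  sym′ (inj₁ p)             = inj₁ (sym E p)
  sym′ (inj₂ (inj₁ (p , q))) = inj₂ (inj₂ (sym E q , sym E p))
  sym′ (inj₂ (inj₂ (p , q))) = inj₂ (inj₁ (sym E q , sym E p))

  trans′ : Transitive (merged P a c)
  trans′ (inj₁ p)             (inj₁ q)             = inj₁ (trans E p q)
  trans′ (inj₁ p)             (inj₂ (inj₁ (q , r))) = inj₂ (inj₁ (trans E p q , r))
  trans′ (inj₁ p)             (inj₂ (inj₂ (q , r))) = inj₂ (inj₂ (trans E p q , r))
  trans′ (inj₂ (inj₁ (p , q))) (inj₁ r)             = inj₂ (inj₁ (p , trans E q r))
  trans′ (inj₂ (inj₁ (p , _))) (inj₂ (inj₁ (_ , s))) = inj₂ (inj₁ (p , s))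
  trans′ (inj₂ (inj₁ (p , _))) (inj₂ (inj₂ (_ , s))) = inj₁ (trans E p s)
  trans′ (inj₂ (inj₂ (p , q))) (inj₁ r)             = inj₂ (inj₂ (p , trans E q r))
  trans′ (inj₂ (inj₂ (p , _))) (inj₂ (inj₁ (_ , s))) = inj₁ (trans E p s)
  trans′ (inj₂ (inj₂ (p , _))) (inj₂ (inj₂ (_ , s))) = inj₂ (inj₂ (p , s))

module _ {F : Triples {n}} {L' : Subset n} where

  merges-isEquivalenceOn : ∀ {P P'} → IsEquivalenceOn L' P → Star (MergeStep F L') P P' →
                           IsEquivalenceOn L' P'
  merges-isEquivalenceOn E ε = E
  merges-isEquivalenceOn E (merge a _ c _ _ _ _ ◅ steps) =
    merges-isEquivalenceOn (merged-isEquivalenceOn a c E) steps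

  merges-⊇ : ∀ {P P'} → Star (MergeStep F L') P P' → P ⇒ P'
  merges-⊇ ε                             = λ p → p
  merges-⊇ (merge _ _ _ _ _ _ _ ◅ steps) = merges-⊇ steps ∘ inj₁

  merges-⊆ : ∀ {R P Q} → IsEquivalenceOn L' Q → AhoEdge R L' ⇒ Q → Stable F L' Q →
             Star (MergeStep F L') (Components R L') P → P ⇒ Q
  merges-⊆ {R} {Q = Q} E edge⇒Q stable = go components⇒Q
    where
    path⇒Q : x ∈ L' → Star (AhoEdge R L') x y → Q x y
    path⇒Q x∈ ε                                  = reflOn E x∈
    path⇒Q _  (e@(_ , (_ , y∈ , _) , _) ◅ path) = trans E (edge⇒Q e) (path⇒Q y∈ path)

    components⇒Q : Components R L' ⇒ Q
    components⇒Q (x∈ , _ , path) = path⇒Q x∈ path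

    step : ∀ {P₀ P₁} → P₀ ⇒ Q → MergeStep F L' P₀ P₁ → P₁ ⇒ Q
    step P₀⇒Q (merge a b c f t Pab _) = λ
      { (inj₁ p)             → P₀⇒Q p
      ; (inj₂ (inj₁ (p , q))) → trans E (trans E (P₀⇒Q p) Qac) (P₀⇒Q q)
      ; (inj₂ (inj₂ (p , q))) → trans E (trans E (P₀⇒Q p) (sym E Qac)) (P₀⇒Q q)
      }
      where Qac = stable a b c f t (P₀⇒Q Pab)

    go : ∀ {P₀ P₁} → P₀ ⇒ Q → Star (MergeStep F L') P₀ P₁ → P₁ ⇒ Q
    go P₀⇒Q ε           = P₀⇒Q
    go P₀⇒Q (s ◅ steps) = go (step P₀⇒Q s) steps

module _ {L' : Subset n} {P : Rel (Fin n) 0ℓ} (E : IsEquivalenceOn L' P) where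

  part⊆ : IsPart L' P D → D ⊆ L'
  part⊆ (_ , _ , D⇔) {y} y∈D = proj₁ (to (D⇔ y) y∈D)

  part-related : IsPart L' P D → x ∈ D → y ∈ D → P x y
  part-related (_ , _ , D⇔) x∈D y∈D =
    trans E (sym E (proj₂ (to (D⇔ _) x∈D))) (proj₂ (to (D⇔ _) y∈D))

  part-closed : IsPart L' P D → x ∈ D → P x y → y ∈ D
  part-closed (_ , _ , D⇔) x∈D p =
    from (D⇔ _) (proj₂ (domain E p) , trans E (proj₂ (to (D⇔ _) x∈D)) p)

  part-unique : ∀ {D'} → IsPart L' P D → IsPart L' P D' → x ∈ D → x ∈ D' → D ≡ D'
  part-unique pD pD' x∈D x∈D' =
    ⊆-antisym (part-closed pD' x∈D' ∘ part-related pD x∈D)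
              (part-closed pD x∈D ∘ part-related pD' x∈D')

  ¬¬-part : x ∈ L' → ¬ ¬ (∃ λ D → IsPart L' P D × x ∈ D)
  ¬¬-part {x} x∈ refute = ¬¬-comprehension (P x) λ (D , D⇔) →
    refute (D , (x , x∈ , λ y → mk⇔ (λ y∈D → proj₂ (domain E (to (D⇔ y) y∈D)) , to (D⇔ y) y∈D)
                                    (from (D⇔ y) ∘ proj₂))
              , from (D⇔ x) (reflOn E x∈))

refineOn : Subset n → Rel (Fin n) 0ℓ → Rel (Fin n) 0ℓ → Rel (Fin n) 0ℓ
refineOn D P_D P x y = (x ∈ D × y ∈ D × P_D x y) ⊎ (x ∉ D × P x y)

module _ {L' D : Subset n} {P P_D : Rel (Fin n) 0ℓ} (E : IsEquivalenceOn L' P) (pD : IsPart L' P D) where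

  refineOn-isEquivalenceOn : IsEquivalenceOn D P_D → IsEquivalenceOn L' (refineOn D P_D P)
  refineOn-isEquivalenceOn E_D = record
    { domain = λ { (inj₁ (x∈ , y∈ , _)) → part⊆ E pD x∈ , part⊆ E pD y∈
                 ; (inj₂ (_ , p))       → domain E p }
    ; reflOn = reflOn′ ; sym = sym′ ; trans = trans′ }
    where
    reflOn′ : x ∈ L' → refineOn D P_D P x x
    reflOn′ {x} x∈ with x ∈? D
    ... | yes x∈D = inj₁ (x∈D , x∈D , reflOn E_D x∈D)
    ... | no  x∉D = inj₂ (x∉D , reflOn E x∈)

    sym′ : Symmetric (refineOn D P_D P)
    sym′ (inj₁ (x∈ , y∈ , p)) = inj₁ (y∈ , x∈ , sym E_D p)
    sym′ (inj₂ (x∉ , p))     = inj₂ ((λ y∈ → x∉ (part-closed E pD y∈ (sym E p))) , sym E p)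

    trans′ : Transitive (refineOn D P_D P)
    trans′ (inj₁ (x∈ , _ , p)) (inj₁ (_ , z∈ , q)) = inj₁ (x∈ , z∈ , trans E_D p q)
    trans′ (inj₁ (_ , y∈ , _)) (inj₂ (y∉ , _))     = ⊥-elim (y∉ y∈)
    trans′ (inj₂ (x∉ , p))     (inj₁ (y∈ , _ , _)) = ⊥-elim (x∉ (part-closed E pD y∈ (sym E p)))
    trans′ (inj₂ (x∉ , p))     (inj₂ (_ , q))      = inj₂ (x∉ , trans E p q)

  refineOn-stable : ∀ {F} → Stable F L' P → Stable F D P_D → Stable F L' (refineOn D P_D P)
  refineOn-stable stable stable_D a b c f t (inj₁ (a∈ , b∈ , p)) =
    inj₁ (a∈ , c∈ , stable_D a b c f (a∈ , b∈ , c∈) p)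
    where c∈ = part-closed E pD a∈ (stable a b c f t (part-related E pD a∈ b∈))
  refineOn-stable stable _ a b c f t (inj₂ (a∉ , p)) = inj₂ (a∉ , stable a b c f t p)

Displays : (Subset n → Set) → Fin n → Fin n → Fin n → Set
Displays H a b c = ∃ λ C → H C × a ∈ C × b ∈ C × c ∉ C

displays-mono : (∀ {C} → H C → H' C) → Displays H a b c → Displays H' a b c
displays-mono H⇒H' (C , HC , a∈ , b∈ , c∉) = C , H⇒H' HC , a∈ , b∈ , c∉

DisplaysAll : (Subset n → Set) → Subset n → Triples {n} → Set
DisplaysAll H L' R = ∀ {a b c} → R a b c → Triple∈ L' a b c → Displays H a b c

_without_ : (Subset n → Set) → Subset n → Subset n → Set
(H without C) C' = H C' × C' ≢ C

module _ {R F : Triples {n}} where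

  mtt-root : MTT R F L' H → H L'
  mtt-root (single _ _ H⇔)          = from (H⇔ _) refl
  mtt-root (split _ _ _ _ _ _ _ H⇔) = from (H⇔ _) (inj₁ refl)

  mtt-⊆ : MTT R F L' H → H C → C ⊆ L'
  mtt-⊆ (single _ _ H⇔) HC with to (H⇔ _) HC
  ... | refl = λ c∈ → c∈
  mtt-⊆ (split _ P merges _ _ _ sub H⇔) HC with to (H⇔ _) HC
  ... | inj₁ refl          = λ c∈ → c∈
  ... | inj₂ (D , pD , hs) =
    part⊆ (merges-isEquivalenceOn (Components-isEquivalenceOn R _) merges) pD ∘ mtt-⊆ (sub D pD) hs

  module Split {L' : Subset n} {H : Subset n → Set} {P : Rel (Fin n) 0ℓ}
               (merges : Star (MergeStep F L') (Components R L') P)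
               (Hs : Subset n → Subset n → Set) (sub : ∀ D → IsPart L' P D → MTT R F D (Hs D))
               (H⇔ : ∀ C → H C ⇔ (C ≡ L' ⊎ Σ (Subset n) λ D → IsPart L' P D × Hs D C)) where

    E : IsEquivalenceOn L' P
    E = merges-isEquivalenceOn (Components-isEquivalenceOn R L') merges

    cluster-cases : H C → C ≡ L' ⊎ Σ (Subset n) λ D → IsPart L' P D × Hs D C
    cluster-cases = to (H⇔ _)

    cluster-of-part : IsPart L' P D → Hs D C → H C
    cluster-of-part pD hs = from (H⇔ _) (inj₂ (_ , pD , hs))

    part-cluster : IsPart L' P D → H D
    part-cluster pD = cluster-of-part pD (mtt-root (sub _ pD))

    proper-cluster-in-part : IsPart L' P D → H C → x ∈ C → x ∈ D → C ≢ L' → Hs D C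
    proper-cluster-in-part pD HC x∈C x∈D C≢L' with cluster-cases HC
    ... | inj₁ C≡L'           = ⊥-elim (C≢L' C≡L')
    ... | inj₂ (D' , pD' , hs) =
      ≡.subst (λ D → Hs D _) (part-unique E pD' pD (mtt-⊆ (sub D' pD') hs x∈C) x∈D) hs

  mtt-displays-R : (∀ {a b c} → R a b c → a ≢ b) →
                   MTT R F L' H → R a b c → Triple∈ L' a b c → ¬ ¬ Displays H a b c
  mtt-displays-R irrefl (single _ L'≡x _) r (a∈ , b∈ , _) _ =
    irrefl r (≡.trans (to (L'≡x _) a∈) (≡.sym (to (L'≡x _) b∈)))
  mtt-displays-R {a = a} {b} {c} irrefl (split _ P merges _ _ Hs sub H⇔) r t@(a∈ , b∈ , _) ¬displayed =
    ¬¬-part E a∈ λ (D , pD , a∈D) →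
      displayed-in-part pD a∈D (part-closed E pD a∈D (merges-⊇ merges (a∈ , b∈ , return (c , t , inj₁ r))))
    where
    open Split merges Hs sub H⇔
    displayed-in-part : IsPart _ P D → a ∈ D → b ∈ D → ⊥
    displayed-in-part {D} pD a∈D b∈D with c ∈? D
    ... | no  c∉D = ¬displayed (D , part-cluster pD , a∈D , b∈D , c∉D)
    ... | yes c∈D = mtt-displays-R irrefl (sub D pD) r (a∈D , b∈D , c∈D)
                      (¬displayed ∘ displays-mono (cluster-of-part pD))

  mtt-¬displays-F : MTT R F L' H → F a b c → Triple∈ L' a b c → ¬ Displays H a b c
  mtt-¬displays-F (single _ _ H⇔) _ (_ , _ , c∈) (C , HC , _ , _ , c∉C) =
    c∉C (≡.subst (_ ∈_) (≡.sym (to (H⇔ C) HC)) c∈)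
  mtt-¬displays-F (split _ P merges stable _ Hs sub H⇔) f t@(_ , _ , c∈) (C , HC , a∈C , b∈C , c∉C)
    with to (H⇔ C) HC
  ... | inj₁ refl          = c∉C c∈
  ... | inj₂ (D , pD , hs) = mtt-¬displays-F (sub D pD) f (a∈D , b∈D , c∈D) (C , hs , a∈C , b∈C , c∉C)
    where
    open Split merges Hs sub H⇔
    a∈D = mtt-⊆ (sub D pD) hs a∈C
    b∈D = mtt-⊆ (sub D pD) hs b∈C
    c∈D = part-closed E pD a∈D (stable _ _ _ f t (part-related E pD a∈D b∈D))

  -- Otherwise refining the partition of L' by the MTT partition of D keeps all Aho edges and
  -- F-stability, so by merges-⊆ the partition of D would have a single part.
  part-essential : ∀ {P} (merges : Star (MergeStep F L') (Components R L') P) → Stable F L' P →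
                   (Hs : Subset n → Subset n → Set) (sub : ∀ D → IsPart L' P D → MTT R F D (Hs D)) →
                   (∀ C → H C ⇔ (C ≡ L' ⊎ Σ (Subset n) λ D → IsPart L' P D × Hs D C)) →
                   IsPart L' P D → (∀ x → D ≢ ⁅ x ⁆) → ¬ DisplaysAll (H without D) L' R
  part-essential {L' = L'} {D = D} merges stable Hs sub H⇔ pD nonleaf displays with sub D pD
  ... | single x D⇔x _ =
    nonleaf x (⊆-antisym (λ y∈ → ≡.subst (_∈ ⁅ x ⁆) (≡.sym (to (D⇔x _) y∈)) (x∈⁅x⁆ x))
                         (from (D⇔x _) ∘ x∈⁅y⁆⇒x≡y x))
  ... | split _ P_D merges_D stable_D one-part-only Hs_D sub_D H_D⇔ =
    one-part-only λ _ _ x∈ y∈ → related-in-D x∈ y∈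
    where
    open Split merges Hs sub H⇔
    module Inside = Split merges_D Hs_D sub_D H_D⇔

    outside-triple⇒related : ∀ {x y z} → x ∈ D → y ∈ D → z ∈ L' → z ∉ D → R x y z → P_D x y
    outside-triple⇒related x∈D y∈D z∈ z∉D r with displays r (part⊆ E pD x∈D , part⊆ E pD y∈D , z∈)
    ... | C , (HC , C≢D) , x∈C , y∈C , z∉C
      with Inside.cluster-cases (proper-cluster-in-part pD HC x∈C x∈D λ { refl → z∉C z∈ })
    ... | inj₁ C≡D             = ⊥-elim (C≢D C≡D)
    ... | inj₂ (D' , pD' , hs) =
      part-related Inside.E pD' (mtt-⊆ (sub_D D' pD') hs x∈C) (mtt-⊆ (sub_D D' pD') hs y∈C)

    edge⇒refined : AhoEdge R L' ⇒ refineOn D P_D _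
    edge⇒refined {x} {y} e@(z , (x∈ , y∈ , z∈) , r) with x ∈? D
    ... | no  x∉D = inj₂ (x∉D , merges-⊇ merges (x∈ , y∈ , return e))
    ... | yes x∈D = inj₁ (x∈D , y∈D , related-inside (z ∈? D) r)
      where
      y∈D = part-closed E pD x∈D (merges-⊇ merges (x∈ , y∈ , return e))
      related-inside : Dec (z ∈ D) → R x y z ⊎ R y x z → P_D x y
      related-inside (yes z∈D) r = merges-⊇ merges_D (x∈D , y∈D , return (z , (x∈D , y∈D , z∈D) , r))
      related-inside (no z∉D) (inj₁ xy|z) = outside-triple⇒related x∈D y∈D z∈ z∉D xy|z
      related-inside (no z∉D) (inj₂ yx|z) = sym Inside.E (outside-triple⇒related y∈D x∈D z∈ z∉D yx|z)

    related-in-D : x ∈ D → y ∈ D → P_D x y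
    related-in-D x∈D y∈D
      with merges-⊆ (refineOn-isEquivalenceOn E pD Inside.E) edge⇒refined
                    (refineOn-stable E pD stable stable_D) merges (part-related E pD x∈D y∈D)
    ... | inj₁ (_ , _ , p) = p
    ... | inj₂ (x∉D , _)   = ⊥-elim (x∉D x∈D)

  mtt-cluster-essential : MTT R F L' H → H C → C ≢ L' → (∀ x → C ≢ ⁅ x ⁆) →
                          ¬ DisplaysAll (H without C) L' R
  mtt-cluster-essential (single _ _ H⇔) HC C≢L' _ _ = C≢L' (to (H⇔ _) HC)
  mtt-cluster-essential {C = C} (split _ P merges stable _ Hs sub H⇔) HC C≢L' nonleaf displays
    with to (H⇔ C) HC
  ... | inj₁ C≡L' = C≢L' C≡L'
  ... | inj₂ (D , pD , hs) with ≡-dec Bool._≟_ C D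
  ...   | yes refl = part-essential merges stable Hs sub H⇔ pD nonleaf displays
  ...   | no  C≢D  = mtt-cluster-essential (sub D pD) hs C≢D nonleaf displays-in-D
    where
    open Split merges Hs sub H⇔
    displays-in-D : DisplaysAll (Hs D without C) D R
    displays-in-D r (a∈ , b∈ , c∈) with displays r (part⊆ E pD a∈ , part⊆ E pD b∈ , part⊆ E pD c∈)
    ... | C' , (HC' , C'≢C) , a∈C' , b∈C' , c∉C' =
      C' , (proper-cluster-in-part pD HC' a∈C' a∈ (λ { refl → c∉C' (part⊆ E pD c∈) }) , C'≢C)
         , a∈C' , b∈C' , c∉C'

module _ (T : Tree n) where

  clusters-nested : Vertex T C → Vertex T D → x ∈ C → x ∈ D → C ⊆ D ⊎ D ⊆ C
  clusters-nested C∈T D∈T x∈C x∈D with compat T _ _ C∈T D∈T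
  ... | inj₁ C⊆D             = inj₁ C⊆D
  ... | inj₂ (inj₁ D⊆C)      = inj₂ D⊆C
  ... | inj₂ (inj₂ disjoint) = ⊥-elim (disjoint (_ , x∈p∩q⁺ (x∈C , x∈D)))

  lca-exists : ∀ x y → ∃ (IsLca T x y)
  lca-exists x y = descend ⊤ (⊂-wellFounded ⊤) (root T) ∈⊤ ∈⊤
    where
    descend : ∀ C → Acc _⊂_ C → Vertex T C → x ∈ C → y ∈ C → ∃ (IsLca T x y)
    descend C (acc smaller) C∈T x∈C y∈C
      with anySubset? (λ D → (isCl T D Bool.≟ true) ×-dec (x ∈? D) ×-dec (y ∈? D) ×-dec (D ⊂? C))
    ... | yes (D , D∈T , x∈D , y∈D , D⊂C) = descend D (smaller D⊂C) D∈T x∈D y∈D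
    ... | no  none                        = C , C∈T , x∈C , y∈C , minimal
      where
      minimal : ∀ D → Vertex T D → x ∈ D → y ∈ D → C ⊆ D
      minimal D D∈T x∈D y∈D with clusters-nested C∈T D∈T x∈C x∈D
      ... | inj₁ C⊆D = C⊆D
      ... | inj₂ D⊆C = λ z∈C → decidable-stable (_ ∈? D) λ z∉D →
                         none (D , D∈T , x∈D , y∈D , D⊆C , _ , z∈C , z∉D)

module _ {σ : Fin n → Fin k} {G : Digraph {n}} where

  ℛ-irreflexive : ℛ G σ a b c → a ≢ b
  ℛ-irreflexive (σa≢σb , _) refl = σa≢σb refl

  -- If c ∈ lca(a, b), then c would be a quasi-best match of a just like b.
  explains-displays-ℛ : {u : Truncation T σ} → Explains T σ u G →
                        ℛ G σ a b c → Displays (Vertex T) a b c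
  explains-displays-ℛ {T = T} {a = a} {b} {c} {u} explains (σa≢σb , σb≡σc , ab , ac)
    with lca-exists T a b
  ... | C , lca@(C∈T , a∈C , b∈C , _) with c ∈? C
  ... | no  c∉C = C , C∈T , a∈C , b∈C , c∉C
  ... | yes c∈C = ⊥-elim (Bool.not-¬ (from (explains a c) c-quasi-best) ac)
    where
    b-quasi-best = to (explains a b) ab

    lca-ac⊆C : IsLca T a c D → D ⊆ C
    lca-ac⊆C (_ , _ , _ , D-minimal) = D-minimal C C∈T a∈C c∈C

    c-quasi-best : QuasiBestMatch T σ u a c
    c-quasi-best =
      ( (λ σa≡σc → σa≢σb (≡.trans σa≡σc (≡.sym σb≡σc)))
      , λ y' σy'≡σc D D' lca-ac lca-ay' →
          proj₂ (proj₁ b-quasi-best) y' (≡.trans σy'≡σc (≡.sym σb≡σc)) C D' lca lca-ay'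
          ∘ lca-ac⊆C lca-ac )
      , λ D lca-ac → ≡.subst (λ s → C ⊆ map u a s) σb≡σc (proj₂ b-quasi-best C lca)
                     ∘ lca-ac⊆C lca-ac

contractions-⊆ : TransClosure Contract T T' → Vertex T' D → Vertex T D
contractions-⊆ [ (_ , _ , _ , _ , T'⇔) ]       = proj₁ ∘ to (T'⇔ _)
contractions-⊆ ((_ , _ , _ , _ , T'⇔) ∷ rest) = proj₁ ∘ to (T'⇔ _) ∘ contractions-⊆ rest

contracted-cluster : TransClosure Contract T T' →
                     ∃ λ C → Vertex T C × C ≢ ⊤ × (∀ x → C ≢ ⁅ x ⁆) ×
                             (∀ {D} → Vertex T' D → (Vertex T without C) D)
contracted-cluster [ (C , C∈T , C≢⊤ , nonleaf , T'⇔) ] =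
  C , C∈T , C≢⊤ , nonleaf , to (T'⇔ _)
contracted-cluster ((C , C∈T , C≢⊤ , nonleaf , T'⇔) ∷ rest) =
  C , C∈T , C≢⊤ , nonleaf , to (T'⇔ _) ∘ contractions-⊆ rest

module ExplainingTruncation (G : Digraph {n}) (σ : Fin n → Fin k) (T : Tree n)
  (bichromatic : ∀ {x y} → G x y ≡ true → σ x ≢ σ y)
  (displays-ℛ : ∀ {a b c} → ℛ G σ a b c → ¬ ¬ Displays (Vertex T) a b c)
  (¬displays-ℱ : ∀ {a b c} → ℱ G σ a b c → ¬ Displays (Vertex T) a b c) where

  HasArcOfColour : Fin n → Fin k → Set
  HasArcOfColour x s = ∃ λ y → σ y ≡ s × G x y ≡ true

  hasArcOfColour? : ∀ x s → Dec (HasArcOfColour x s)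
  hasArcOfColour? x s = any? λ y → (σ y ≟ᶠ s) ×-dec (G x y Bool.≟ true)

  truncate : Fin n → Fin k → Subset n
  truncate x s with hasArcOfColour? x s
  ... | yes _ = ⊤
  ... | no  _ = ⁅ x ⁆

  u : Truncation T σ
  u = record { map = truncate ; vertex = vertex′ ; onPath = onPath′ ; self = self′ }
    where
    vertex′ : ∀ x s → Vertex T (truncate x s)
    vertex′ x s with hasArcOfColour? x s
    ... | yes _ = root T
    ... | no  _ = leaves T x

    onPath′ : ∀ x s → x ∈ truncate x s
    onPath′ x s with hasArcOfColour? x s
    ... | yes _ = ∈⊤
    ... | no  _ = x∈⁅x⁆ x

    self′ : ∀ x → truncate x (σ x) ≡ ⁅ x ⁆
    self′ x with hasArcOfColour? x (σ x)
    ... | yes (_ , σy≡σx , xy) = ⊥-elim (bichromatic xy (≡.sym σy≡σx))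
    ... | no  _                = refl

  arc⇒bestMatch : G x y ≡ true → BestMatch T σ x y
  arc⇒bestMatch {x} {y} xy = bichromatic xy , best
    where
    best : ∀ y' → σ y' ≡ σ y → ∀ C C' → IsLca T x y C → IsLca T x y' C' → C ⊆ C'
    best y' σy'≡σy C C' (_ , _ , _ , C-minimal) (C'∈T , x∈C' , y'∈C' , _) with y ∈? C'
    ... | yes y∈C' = C-minimal C' C'∈T x∈C' y∈C'
    ... | no  y∉C' with G x y' in xy'
    ...   | true  = ⊥-elim (¬displays-ℱ
                       (bichromatic xy' , σy'≡σy , (λ { refl → y∉C' y'∈C' }) , xy' , xy)
                       (C' , C'∈T , x∈C' , y'∈C' , y∉C'))
    ...   | false = ⊥-elim (displays-ℛ (bichromatic xy , ≡.sym σy'≡σy , xy , xy') λ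
                       (E , E∈T , x∈E , y∈E , y'∉E) →
                         case-nested y∈E y'∉E (clusters-nested T C'∈T E∈T x∈C' x∈E))
      where
      case-nested : ∀ {E} → y ∈ E → y' ∉ E → C' ⊆ E ⊎ E ⊆ C' → ⊥
      case-nested y∈E y'∉E (inj₁ C'⊆E) = y'∉E (C'⊆E y'∈C')
      case-nested y∈E y'∉E (inj₂ E⊆C') = y∉C' (E⊆C' y∈E)

  arc⇒quasiBestMatch : G x y ≡ true → QuasiBestMatch T σ u x y
  arc⇒quasiBestMatch {x} {y} xy = arc⇒bestMatch xy , λ _ _ → below-root
    where
    below-root : C ⊆ truncate x (σ y)
    below-root with hasArcOfColour? x (σ y)
    ... | yes _  = ⊆⊤
    ... | no  no-arc = ⊥-elim (no-arc (y , refl , xy))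

  quasiBestMatch⇒arc : QuasiBestMatch T σ u x y → G x y ≡ true
  quasiBestMatch⇒arc {x} {y} ((σx≢σy , best) , under) with G x y in xy
  ... | true  = refl
  ... | false with lca-exists T x y
  ...   | C , lca@(_ , _ , y∈C , _) = ⊥-elim (not-below (under C lca))
    where
    not-below : ¬ C ⊆ truncate x (σ y)
    not-below with hasArcOfColour? x (σ y)
    ... | no  _ = λ C⊆x → σx≢σy (≡.cong σ (≡.sym (x∈⁅y⁆⇒x≡y x (C⊆x y∈C))))
    ... | yes (y' , σy'≡σy , xy') = λ _ →
      displays-ℛ ((λ σx≡σy' → σx≢σy (≡.trans σx≡σy' σy'≡σy)) , σy'≡σy , xy' , xy) λ
        (E , E∈T , x∈E , y'∈E , y∉E) →
          let (C' , lca'@(_ , _ , _ , C'-minimal)) = lca-exists T x y'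
          in  y∉E (C'-minimal E E∈T x∈E y'∈E (best y' σy'≡σy C C' lca lca' y∈C))

  explains : Explains T σ u G
  explains x y = mk⇔ arc⇒quasiBestMatch quasiBestMatch⇒arc

proposition5 : {n k : ℕ} (G : Digraph {n}) (σ : Fin n → Fin k) →
    IsQBMG G σ →
    (T : Tree n) → MTT (ℛ G σ) (ℱ G σ) ⊤ (λ C → isCl T C ≡ true) →
    Σ (Truncation T σ) λ u → Explains T σ u G × LeastResolved T σ u G
proposition5 G σ (_ , _ , explains₀) T mtt = u , explains , least-resolved
  where
  open ExplainingTruncation G σ T
         (λ {x} {y} xy → proj₁ (proj₁ (to (explains₀ x y) xy)))
         (λ r → mtt-displays-R (ℛ-irreflexive {G = G}) mtt r (∈⊤ , ∈⊤ , ∈⊤))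
         (λ f → mtt-¬displays-F mtt f (∈⊤ , ∈⊤ , ∈⊤))

  least-resolved : LeastResolved T σ u G
  least-resolved (_ , contractions , u′ , explains′) with contracted-cluster contractions
  ... | C , C∈T , C≢⊤ , nonleaf , T′⊆T∖C =
    mtt-cluster-essential mtt C∈T C≢⊤ nonleaf λ r _ →
      displays-mono T′⊆T∖C (explains-displays-ℛ {u = u′} explains′ r)
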